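{- Let $D$ be a tournament with involution. Then $D$ is homomorphism-homogeneous if and only if $D\cong\zeta_4$ or $D\cong\alpha_n$ for some $n\ge0$.
   Context: A (finite) digraph $D=(V,E)$, $E\subseteq V^2$; $x\to y$ means $(x,y)\in E$, $x\sim y$ means $x\to y$ or $y\to x$, $x\rightleftarrows y$ means both. Reflexive: all loops present. Improper: $E$ neither symmetric nor antisymmetric. Homomorphism: vertex map with $x\to y\Rightarrow f(x)\to f(y)$; $D[W]$ the induced subdigraph. $D$ is homomorphism-homogeneous if every homomorphism $D[U]\to D[W]$ ($U,W$ nonempty) extends to an endomorphism of $D$. A digraph with involution is a reflexive improper digraph $D$ with an automorphism $x\mapsto x'$ satisfying (DI1) $x''=x$; (DI2) $x\to y\Rightarrow y\to x'$; (DI3) if $x\ne y$ and $x\rightleftarrows y$ then $y=x'$. It is a tournament with involution if moreover $x\sim y$ for all $x,y\in V$. Construction: for a reflexive tournament $B$ (a reflexive digraph in which every pair of distinct vertices is joined by exactly one edge direction), let $T(B)$ have vertex set $B\cup B'$ where $B'=\{b':b\in B\}$ is a disjoint copy, with loops at all vertices, $b\rightleftarrows b'$ for all $b\in B$, and for every edge $a\to b$ of $B$ with $a\ne b$ the edges $a\to b$, $b\to a'$, $a'\to b'$, $b'\to a$ (and no others). $\alpha_0=\mathbf{1}^\circ$ (one vertex with a loop); for $n\ge1$, $\alpha_n=T(B)$ where $B$ is the transitive reflexive tournament on $n$ vertices (the acyclic tournament with involution on $2n$ vertices). $\zeta_4=T(B_4)$ where $B_4$ is the reflexive tournament on $\{s,p,q,r\}$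 with $p\to q\to r\to p$ and $p\to s$, $q\to s$, $r\to s$. -}

module Defs where

open import Data.Nat using (ℕ; zero; suc; _+_)
open import Data.Fin using (Fin; zero; suc; splitAt; _≤?_)
open import Data.Fin.Properties using (_≟_)
open import Data.Fin.Subset using (Subset; _∈_; Nonempty)
open import Data.Bool using (Bool; true; false; T; _∧_; _∨_; not)
open import Data.Sum using (_⊎_; inj₁; inj₂)
open import Data.Product using (Σ; ∃; _×_; _,_)
open import Relation.Nullary using (¬_; ⌊_⌋)
open import Relation.Binary.PropositionalEquality using (_≡_; _≢_)

record Digraph : Set where
  constructor digraph
  field
    size : ℕ
    adj  : Fin size → Fin size → Bool

open Digraph public

Edge : (D : Digraph) → Fin (size D) → Fin (size D) → Set
Edge D x y = T (adj D x y)

Adjacent : (D : Digraph) → Fin (size D) → Fin (size D) → Set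
Adjacent D x y = Edge D x y ⊎ Edge D y x

BothWays : (D : Digraph) → Fin (size D) → Fin (size D) → Set
BothWays D x y = Edge D x y × Edge D y x

Reflexive : Digraph → Set
Reflexive D = ∀ x → Edge D x x

SymmetricE : Digraph → Set
SymmetricE D = ∀ x y → Edge D x y → Edge D y x

AntisymmetricE : Digraph → Set
AntisymmetricE D = ∀ x y → Edge D x y → Edge D y x → x ≡ y

Improper : Digraph → Set
Improper D = ¬ SymmetricE D × ¬ AntisymmetricE D

IsAutomorphism : (D : Digraph) → (Fin (size D) → Fin (size D)) → Set
IsAutomorphism D f =
  (Σ (Fin (size D) → Fin (size D)) λ g → (∀ x → g (f x) ≡ x) × (∀ x → f (g x) ≡ x))
  × (∀ x y → (Edge D x y → Edge D (f x) (f y)) × (Edge D (f x) (f y) → Edge D x y))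

IsDigraphWithInvolution : (D : Digraph) → (Fin (size D) → Fin (size D)) → Set
IsDigraphWithInvolution D inv =
  Reflexive D × Improper D × IsAutomorphism D inv
  × (∀ x → inv (inv x) ≡ x)
  × (∀ x y → Edge D x y → Edge D y (inv x))
  × (∀ x y → x ≢ y → BothWays D x y → y ≡ inv x)

IsTournamentWithInvolution : (D : Digraph) → (Fin (size D) → Fin (size D)) → Set
IsTournamentWithInvolution D inv =
  IsDigraphWithInvolution D inv × (∀ x y → Adjacent D x y)

IsHomFromTo : (D : Digraph) (U W : Subset (size D))
  → ((x : Fin (size D)) → x ∈ U → Fin (size D)) → Set
IsHomFromTo D U W h =
  (∀ x (p : x ∈ U) → h x p ∈ W)
  × (∀ x y (p : x ∈ U) (q : y ∈ U) → Edge D x y → Edge D (h x p) (h y q))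

IsEndomorphism : (D : Digraph) → (Fin (size D) → Fin (size D)) → Set
IsEndomorphism D F = ∀ x y → Edge D x y → Edge D (F x) (F y)

HomHomogeneous : Digraph → Set
HomHomogeneous D =
  (U W : Subset (size D)) → Nonempty U → Nonempty W
  → (h : (x : Fin (size D)) → x ∈ U → Fin (size D))
  → IsHomFromTo D U W h
  → Σ (Fin (size D) → Fin (size D)) λ F →
      IsEndomorphism D F × (∀ x (p : x ∈ U) → F x ≡ h x p)

_≅_ : Digraph → Digraph → Set
D ≅ E =
  Σ (Fin (size D) → Fin (size E)) λ f →
  Σ (Fin (size E) → Fin (size D)) λ g →
    (∀ x → g (f x) ≡ x) × (∀ y → f (g y) ≡ y)
    × (∀ x y → (Edge D x y → Edge E (f x) (f y)) × (Edge E (f x) (f y) → Edge D x y))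

-- Vertices: Fin (k + k); the first k are b ∈ B, the last k are the copies b'.
-- Edges: loops everywhere; b ⇄ b'; for each a → b in B with a ≢ b:
--   a → b, b → a', a' → b', b' → a.
TAdj : (k : ℕ) → (Fin k → Fin k → Bool) → Fin (k + k) → Fin (k + k) → Bool
TAdj k B u v with splitAt k u | splitAt k v
... | inj₁ a | inj₁ b = ⌊ a ≟ b ⌋ ∨ (B a b ∧ not ⌊ a ≟ b ⌋)
... | inj₂ a | inj₂ b = ⌊ a ≟ b ⌋ ∨ (B a b ∧ not ⌊ a ≟ b ⌋)
... | inj₁ x | inj₂ y = ⌊ x ≟ y ⌋ ∨ (B y x ∧ not ⌊ y ≟ x ⌋)      -- x → x'; x → y' from y → x
... | inj₂ x | inj₁ y = ⌊ x ≟ y ⌋ ∨ (B y x ∧ not ⌊ y ≟ x ⌋)      -- x' → x; x' → y from y → x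

TB : (k : ℕ) → (Fin k → Fin k → Bool) → Digraph
TB k B = digraph (k + k) (TAdj k B)

transTour : (n : ℕ) → Fin n → Fin n → Bool
transTour n i j = ⌊ i ≤? j ⌋

α : ℕ → Digraph
α zero    = digraph 1 (λ _ _ → true)
α (suc n) = TB (suc n) (transTour (suc n))

-- B₄ on {s,p,q,r} = {0,1,2,3}: p → q → r → p and p,q,r → s; loops everywhere.
B₄ : Fin 4 → Fin 4 → Bool
B₄ zero zero = true
B₄ zero _ = false
B₄ (suc zero) zero = true
B₄ (suc zero) (suc zero) = true
B₄ (suc zero) (suc (suc zero)) = true
B₄ (suc zero) (suc (suc (suc zero))) = false
B₄ (suc (suc zero)) zero = true
B₄ (suc (suc zero)) (suc zero) = false
B₄ (suc (suc zero)) (suc (suc zero)) = true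
B₄ (suc (suc zero)) (suc (suc (suc zero))) = true
B₄ (suc (suc (suc zero))) zero = true
B₄ (suc (suc (suc zero))) (suc zero) = true
B₄ (suc (suc (suc zero))) (suc (suc zero)) = false
B₄ (suc (suc (suc zero))) (suc (suc (suc zero))) = true

ζ₄ : Digraph
ζ₄ = TB 4 B₄

-- The strict in-neighbourhoods In°(v) = {x | x → v, v ↛ x} govern everything. If none of them
-- contains a strict 3-cycle, the out-neighbours of a fixed v₀ other than v₀′ are linearly ordered
-- by →, and D = T(B) for that transitive tournament B, i.e. D ≅ αₙ. If some In°(v) contains a
-- 3-cycle a → b → c → a, then v, a, b, c span a copy of B₄. Any further vertex would span with
-- them a copy of T(B₄ + one vertex), and for each of the 16 ways it can attach a computed witness
-- exhibits a homomorphism on four in-neighbours of some vertex u whose image contains x ⇄ x′ and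
-- vertices not dominating x, resp. x′; it cannot extend to u. Hence D ≅ ζ₄ under homogeneity.
-- Conversely, a partial homomorphism g on Q extends to v ∉ Q once the images, flipped to
-- (g u)′ whenever v → u, have a common out-neighbour. Flipped the same way, Q lands in In°(v),
-- where a finite tournament has a source or a 3-cycle: a source's image gives the bound; in αₙ
-- there are no such cycles, and in ζ₄ a cycle is all of In°(v) and its image is bounded above.
module Submission where

open import Defs
open import Data.Nat using (ℕ; zero; suc; _+_; _≤_; _<_; s≤s)
import Data.Nat.Properties as ℕ
open import Data.Fin using (Fin; zero; suc; toℕ; splitAt; join; _≤?_; #_) renaming (_<_ to _<ᶠ_)
open import Data.Fin.Properties
  using (_≟_; any?; all?; toℕ<n; ≤-total; ≤∧≢⇒<; splitAt-join; join-splitAt)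
open import Data.Fin.Subset using (Subset) renaming (_∈_ to _∈ₛ_; ⊤ to ⊤ₛ)
open import Data.Fin.Subset.Properties using (∈⊤) renaming (_∈?_ to _∈ₛ?_)
open import Data.Bool using (Bool; true; false; T; not; _∧_; _∨_)
open import Data.Bool.Properties using (T?; ∧-identityʳ)
open import Data.Unit using (⊤; tt)
open import Data.Empty using (⊥)
open import Data.Product using (Σ; ∃; ∃-syntax; _×_; _,_; proj₁; proj₂)
open import Data.Sum using (_⊎_; inj₁; inj₂; [_,_]′; swap; reduce)
open import Data.Vec using (Vec; []; _∷_; lookup; tabulate; here; there)
import Data.Vec as Vec
open import Data.Vec.Properties using (lookup-map; lookup∘tabulate; lookup⇒[]=; []=⇒lookup)
open import Data.List using (List; []; _∷_; length; filter; allFin)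
import Data.List as List
open import Data.List.Relation.Unary.All as All using (All; []; _∷_)
open import Data.List.Relation.Unary.All.Properties as All using (all-filter; ¬All⇒Any¬)
open import Data.List.Relation.Unary.Any as Any using (Any; here; there)
import Data.List.Relation.Unary.Any.Properties as Any
open import Data.List.Relation.Unary.AllPairs as AllPairs using (AllPairs; []; _∷_)
import Data.List.Relation.Unary.AllPairs.Properties as AllPairs
open import Data.List.Relation.Unary.Linked.Properties using (Linked⇒AllPairs)
open import Data.List.Relation.Unary.Unique.Propositional.Properties using (allFin⁺; filter⁺)
open import Data.List.Membership.Propositional using (_∈_; find)
open import Data.List.Membership.Propositional.Properties
  using (∈-allFin; ∈-filter⁺; ∈-lookup; ∈-map⁻)
import Data.List.Relation.Binary.Permutation.Setoid as Permutation
import Data.List.Relation.Binary.Permutation.Setoid.Properties as Permutation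
import Data.List.Sort as Sort
open import Function using (_∘_; id; _on_; case_of_)
open import Relation.Binary using (DecTotalOrder)
import Relation.Binary.Construct.On as On
open import Relation.Binary.PropositionalEquality
open import Relation.Nullary using (¬_; Dec; yes; no; does; ⌊_⌋; ¬?; contradiction)
open import Relation.Nullary.Decidable
  using (True; toWitness; fromWitness; dec-true; _×-dec_; _⊎-dec_; _→-dec_)
open import Relation.Unary using (Decidable)

-- Finite sets

AllPairs-lookup : ∀ {A : Set} {R : A → A → Set} {xs : List A} → AllPairs R xs
  → ∀ {i j} → i <ᶠ j → R (List.lookup xs i) (List.lookup xs j)
AllPairs-lookup {xs = _ ∷ _} (Rx ∷ _) {zero} {suc j} _ = All.lookup Rx (∈-lookup j)
AllPairs-lookup {xs = _ ∷ _} (_ ∷ Rxs) {suc i} {suc j} (s≤s i<j) = AllPairs-lookup Rxs i<j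

record Enumeration {n : ℕ} (P : Fin n → Set) (_≼_ : Fin n → Fin n → Set) : Set where
  field
    count : ℕ
    enum : Fin count → Fin n
    enum-∈ : ∀ i → P (enum i)
    enum-strictMono : ∀ {i j} → i <ᶠ j → enum i ≼ enum j × enum i ≢ enum j
    enum-onto : ∀ {x} → P x → ∃ λ i → enum i ≡ x

module _ {n : ℕ} {P : Fin n → Set} (P? : Decidable P)
         {_≼_ : Fin n → Fin n → Set} (_≼?_ : ∀ x y → Dec (x ≼ y))
         (≼-refl : ∀ x → x ≼ x)
         (≼-trans : ∀ {x y z} → P x → P y → P z → x ≼ y → y ≼ z → x ≼ z)
         (≼-antisym : ∀ {x y} → P x → P y → x ≼ y → y ≼ x → x ≡ y)
         (≼-total : ∀ {x y} → P x → P y → x ≼ y ⊎ y ≼ x) where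

  private
    Elem : Set
    Elem = Σ (Fin n) P

    -- ≼ is only a total order on P, so sort the elements of P, up to their first components
    order : DecTotalOrder _ _ _
    order = record
      { Carrier = Elem
      ; _≈_ = _≡_ on proj₁
      ; _≤_ = _≼_ on proj₁
      ; isDecTotalOrder = record
        { isTotalOrder = record
          { isPartialOrder = record
            { isPreorder = record
              { isEquivalence = On.isEquivalence proj₁ isEquivalence
              ; reflexive = λ { {x , _} refl → ≼-refl x }
              ; trans = λ { {_ , px} {_ , py} {_ , pz} → ≼-trans px py pz }
              }
            ; antisym = λ { {_ , px} {_ , py} → ≼-antisym px py }
            }
          ; total = λ { (_ , px) (_ , py) → ≼-total px py }
          }
        ; _≟_ = λ x y → proj₁ x ≟ proj₁ y
        ; _≤?_ = λ x y → proj₁ x ≼? proj₁ y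
        }
      }

    open DecTotalOrder order using (module Eq)
    open Sort.SortingAlgorithm order (Sort.sortingAlgorithm order) using (sort; sort-↗; sort-↭ₛ)

    members : All P (filter P? (allFin n))
    members = all-filter P? (allFin n)

    elems : List Elem
    elems = All.toList members

    proj₁-toList : ∀ {xs} (pxs : All P xs) → List.map proj₁ (All.toList pxs) ≡ xs
    proj₁-toList [] = refl
    proj₁-toList (_ ∷ pxs) = cong (_ ∷_) (proj₁-toList pxs)

    sorted : List Elem
    sorted = sort elems

    elems↭sorted : Permutation._↭_ Eq.setoid elems sorted
    elems↭sorted = Permutation.↭-sym Eq.setoid (sort-↭ₛ elems)

    sorted-unique : AllPairs (λ x y → proj₁ x ≢ proj₁ y) sorted
    sorted-unique = Permutation.Unique-resp-↭ Eq.setoid elems↭sorted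
      (AllPairs.map⁻ (subst (AllPairs _≢_) (sym (proj₁-toList members)) (filter⁺ P? (allFin⁺ n))))

    sorted-increasing : AllPairs (λ x y → proj₁ x ≼ proj₁ y × proj₁ x ≢ proj₁ y) sorted
    sorted-increasing = AllPairs.zip
      (Linked⇒AllPairs (λ {x y z} → DecTotalOrder.trans order {x} {y} {z}) (sort-↗ elems) , sorted-unique)

    sorted-complete : ∀ {x} → P x → Any (λ e → x ≡ proj₁ e) sorted
    sorted-complete {x} px = Permutation.∈-resp-↭ Eq.setoid {x = x , px} elems↭sorted
      (Any.map⁻ (subst (Any (x ≡_)) (sym (proj₁-toList members)) (∈-filter⁺ P? (∈-allFin x) px)))

  enumerate : Enumeration P _≼_
  enumerate = record
    { count = length sorted
    ; enum = λ i → proj₁ (List.lookup sorted i)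
    ; enum-∈ = λ i → proj₂ (List.lookup sorted i)
    ; enum-strictMono = AllPairs-lookup sorted-increasing
    ; enum-onto = λ px → let p = sorted-complete px in Any.index p , sym (Any.lookup-index p)
    }

subset : ∀ {n} {P : Fin n → Set} → Decidable P → Subset n
subset P? = tabulate (does ∘ P?)

∈-subset⁺ : ∀ {n} {P : Fin n → Set} (P? : Decidable P) {x} → P x → x ∈ₛ subset P?
∈-subset⁺ P? {x} px = lookup⇒[]= x _ (trans (lookup∘tabulate _ x) (dec-true (P? x) px))

∈-subset⁻ : ∀ {n} {P : Fin n → Set} (P? : Decidable P) {x} → x ∈ₛ subset P? → P x
∈-subset⁻ P? {x} x∈ with P? x | trans (sym ([]=⇒lookup x∈)) (lookup∘tabulate (does ∘ P?) x)
... | yes px | _ = px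
... | no _ | ()

∈ₛ-irrelevant : ∀ {n} {x : Fin n} {U : Subset n} (p q : x ∈ₛ U) → p ≡ q
∈ₛ-irrelevant here here = refl
∈ₛ-irrelevant (there p) (there q) = cong there (∈ₛ-irrelevant p q)

-- Strict edges and triangles

Vertex : Digraph → Set
Vertex G = Fin (size G)

Edge? : (G : Digraph) → ∀ x y → Dec (Edge G x y)
Edge? G x y = T? (adj G x y)

Strict : (G : Digraph) → Vertex G → Vertex G → Set
Strict G x y = Edge G x y × ¬ Edge G y x

Strict? : (G : Digraph) → ∀ x y → Dec (Strict G x y)
Strict? G x y = Edge? G x y ×-dec ¬? (Edge? G y x)

Triangle : (G : Digraph) → Vertex G → Vertex G → Vertex G → Set
Triangle G a b c = Strict G a b × Strict G b c × Strict G c a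

InTriangle : (G : Digraph) → Vertex G → Vertex G → Vertex G → Vertex G → Set
InTriangle G v a b c = (Strict G a v × Strict G b v × Strict G c v) × Triangle G a b c

InTriangle? : (G : Digraph) → ∀ v a b c → Dec (InTriangle G v a b c)
InTriangle? G v a b c = (Strict? G a v ×-dec Strict? G b v ×-dec Strict? G c v)
  ×-dec Strict? G a b ×-dec Strict? G b c ×-dec Strict? G c a

NoInTriangle : Digraph → Set
NoInTriangle G = ∀ v a b c → ¬ InTriangle G v a b c

InTriangleExhausts : Digraph → Set
InTriangleExhausts G =
  ∀ v a b c x → InTriangle G v a b c → Strict G x v → x ≡ a ⊎ x ≡ b ⊎ x ≡ c

TrianglesBoundedAbove : Digraph → Set
TrianglesBoundedAbove G =
  ∀ a b c → Triangle G a b c → ∃ λ t → Edge G a t × Edge G b t × Edge G c t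

-- the in-neighbourhood shapes of αₙ (left) and of ζ₄ (right)
InTriangleCondition : Digraph → Set
InTriangleCondition G = NoInTriangle G ⊎ (InTriangleExhausts G × TrianglesBoundedAbove G)

module _ {D G : Digraph} (iso : D ≅ G) where
  private
    f : Vertex D → Vertex G
    f = proj₁ iso

    g : Vertex G → Vertex D
    g = proj₁ (proj₂ iso)

    g∘f : ∀ x → g (f x) ≡ x
    g∘f = proj₁ (proj₂ (proj₂ iso))

    f∘g : ∀ y → f (g y) ≡ y
    f∘g = proj₁ (proj₂ (proj₂ (proj₂ iso)))

    preserves : ∀ {x y} → Edge D x y → Edge G (f x) (f y)
    preserves {x} {y} = proj₁ (proj₂ (proj₂ (proj₂ (proj₂ iso))) x y)

    reflects : ∀ {x y} → Edge G (f x) (f y) → Edge D x y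
    reflects {x} {y} = proj₂ (proj₂ (proj₂ (proj₂ (proj₂ iso))) x y)

    f-injective : ∀ {x y} → f x ≡ f y → x ≡ y
    f-injective {x} {y} eq = trans (sym (g∘f x)) (trans (cong g eq) (g∘f y))

    strict : ∀ {x y} → Strict D x y → Strict G (f x) (f y)
    strict (xy , y↛x) = preserves xy , y↛x ∘ reflects

    triangle : ∀ {a b c} → Triangle D a b c → Triangle G (f a) (f b) (f c)
    triangle (ab , bc , ca) = strict ab , strict bc , strict ca

    inTriangle : ∀ {v a b c} → InTriangle D v a b c → InTriangle G (f v) (f a) (f b) (f c)
    inTriangle ((av , bv , cv) , abc) = (strict av , strict bv , strict cv) , triangle abc

  NoInTriangle-transport : NoInTriangle G → NoInTriangle D
  NoInTriangle-transport none v a b c = none (f v) (f a) (f b) (f c) ∘ inTriangle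

  InTriangleExhausts-transport : InTriangleExhausts G → InTriangleExhausts D
  InTriangleExhausts-transport exhausts v a b c x abc xv
    with exhausts (f v) (f a) (f b) (f c) (f x) (inTriangle abc) (strict xv)
  ... | inj₁ x≡a = inj₁ (f-injective x≡a)
  ... | inj₂ (inj₁ x≡b) = inj₂ (inj₁ (f-injective x≡b))
  ... | inj₂ (inj₂ x≡c) = inj₂ (inj₂ (f-injective x≡c))

  TrianglesBoundedAbove-transport : TrianglesBoundedAbove G → TrianglesBoundedAbove D
  TrianglesBoundedAbove-transport bounded a b c abc
    with bounded (f a) (f b) (f c) (triangle abc)
  ... | t , at , bt , ct = g t , pull at , pull bt , pull ct
    where
    pull : ∀ {x} → Edge G (f x) t → Edge D x (g t)
    pull {x} xt = reflects (subst (Edge G (f x)) (sym (f∘g t)) xt)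

  InTriangleCondition-transport : InTriangleCondition G → InTriangleCondition D
  InTriangleCondition-transport (inj₁ none) = inj₁ (NoInTriangle-transport none)
  InTriangleCondition-transport (inj₂ (exhausts , bounded)) =
    inj₂ (InTriangleExhausts-transport exhausts , TrianglesBoundedAbove-transport bounded)

module _ {D : Digraph} {P : Vertex D → Set}
         (total : ∀ x y → Edge D x y ⊎ Edge D y x)
         (antisym : ∀ {x y} → P x → P y → Edge D x y → Edge D y x → x ≡ y) where

  private
    reverse : ∀ {x y} → ¬ Edge D x y → Edge D y x
    reverse {x} {y} x↛y = [ (λ xy → contradiction xy x↛y) , id ]′ (total x y)

  source-or-triangle : ∀ {x xs} → All P (x ∷ xs)
    → (∃ λ m → m ∈ x ∷ xs × All (Edge D m) (x ∷ xs))
    ⊎ (∃[ a ] ∃[ b ] ∃[ c ] (a ∈ x ∷ xs × b ∈ x ∷ xs × c ∈ x ∷ xs) × Triangle D a b c)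
  source-or-triangle {x} {[]} _ = inj₁ (x , here refl , reduce (total x x) ∷ [])
  source-or-triangle {x} {y ∷ ys} (_ ∷ pys) with source-or-triangle pys
  ... | inj₂ (a , b , c , (a∈ , b∈ , c∈) , abc) =
    inj₂ (a , b , c , (there a∈ , there b∈ , there c∈) , abc)
  ... | inj₁ (m , m∈ , m→) with Edge? D m x
  ...   | yes m→x = inj₁ (m , there m∈ , m→x ∷ m→)
  ...   | no m↛x with All.all? (Edge? D x) (y ∷ ys)
  ...     | yes x→ = inj₁ (x , here refl , reduce (total x x) ∷ x→)
  ...     | no x↛ with find (¬All⇒Any¬ (Edge? D x) (y ∷ ys) x↛)
  ...       | z , z∈ , x↛z = inj₂ (x , m , z , (here refl , there m∈ , there z∈)
                                   , (reverse m↛x , m↛x) , (m→z , z↛m) , (reverse x↛z , x↛z))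
    where
    m→z : Edge D m z
    m→z = All.lookup m→ z∈

    -- z → m would force z = m, and then x → m contradicts x ↛ z
    z↛m : ¬ Edge D z m
    z↛m z→m = x↛z (subst (Edge D x) (antisym (All.lookup pys m∈) (All.lookup pys z∈) m→z z→m)
                                     (reverse m↛x))

-- Homomorphism-homogeneity

homHomogeneous⇒commonOutNeighbour : ∀ {D} → HomHomogeneous D
  → ∀ {m} v (sources images : Fin (suc m) → Vertex D)
  → (∀ i → Edge D (sources i) v) → (∀ i j → sources i ≡ sources j → i ≡ j)
  → (∀ i j → Edge D (sources i) (sources j) → Edge D (images i) (images j))
  → ∃ λ t → ∀ i → Edge D (images i) t
homHomogeneous⇒commonOutNeighbour {D} hh v s m s→v s-inj m-hom =
  F v , λ i → subst (λ y → Edge D y (F v)) (F∘s i) (F-endo (s i) v (s→v i))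
  where
  index? : Decidable (λ y → ∃ λ i → y ≡ s i)
  index? y = any? (λ i → y ≟ s i)

  s∈U : ∀ i → s i ∈ₛ subset index?
  s∈U i = ∈-subset⁺ index? (i , refl)

  h : ∀ x → x ∈ₛ subset index? → Vertex D
  h x p = m (proj₁ (∈-subset⁻ index? p))

  h-hom : ∀ x y p q → Edge D x y → Edge D (h x p) (h y q)
  h-hom x y p q with ∈-subset⁻ index? p | ∈-subset⁻ index? q
  ... | i , refl | j , refl = m-hom i j

  extension = hh (subset index?) ⊤ₛ (s zero , s∈U zero) (s zero , ∈⊤) h ((λ _ _ → ∈⊤) , h-hom)
  F = proj₁ extension
  F-endo = proj₁ (proj₂ extension)

  F∘s : ∀ i → F (s i) ≡ m i
  F∘s i with ∈-subset⁻ index? (s∈U i) | proj₂ (proj₂ extension) (s i) (s∈U i)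
  ... | j , eq | F≡h rewrite s-inj i j eq = F≡h

PartialHom : (D : Digraph) → (Vertex D → Set) → (Vertex D → Vertex D) → Set
PartialHom D Q g = ∀ {x y} → Q x → Q y → Edge D x y → Edge D (g x) (g y)

OnePointExtension : Digraph → Set₁
OnePointExtension D =
  ∀ {Q : Vertex D → Set} → Decidable Q → ∀ {g} → PartialHom D Q g → ∀ {v} → ¬ Q v
  → ∃ λ t → ∀ {u} → Q u → (Edge D u v → Edge D (g u) t) × (Edge D v u → Edge D t (g u))

module _ {D : Digraph} (loop : Reflexive D) (extend : OnePointExtension D) where
  private
    V : Set
    V = Vertex D

  extendByVertex : ∀ {Q} → Decidable Q → ∀ {g} → PartialHom D Q g → ∀ v
    → ∃ λ g′ → PartialHom D (λ x → Q x ⊎ x ≡ v) g′ × (∀ {x} → Q x → g′ x ≡ g x)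
  extendByVertex {Q} Q? {g} hom v with Q? v
  ... | yes qv = g , (λ p q → hom (inQ p) (inQ q)) , λ _ → refl
    where
    inQ : ∀ {x} → Q x ⊎ x ≡ v → Q x
    inQ (inj₁ qx) = qx
    inQ (inj₂ refl) = qv
  ... | no ¬qv = g′ , hom′ , agree
    where
    t = proj₁ (extend Q? hom ¬qv)
    t-fits = proj₂ (extend Q? hom ¬qv)

    g′ : V → V
    g′ x with x ≟ v
    ... | yes _ = t
    ... | no _ = g x

    inQ : ∀ {x} → x ≢ v → Q x ⊎ x ≡ v → Q x
    inQ _ (inj₁ qx) = qx
    inQ x≢v (inj₂ x≡v) = contradiction x≡v x≢v

    hom′ : PartialHom D (λ x → Q x ⊎ x ≡ v) g′
    hom′ {x} {y} p q with x ≟ v | y ≟ v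
    ... | yes refl | yes refl = λ _ → loop t
    ... | yes refl | no y≢v = proj₂ (t-fits (inQ y≢v q))
    ... | no x≢v | yes refl = proj₁ (t-fits (inQ x≢v p))
    ... | no x≢v | no y≢v = hom (inQ x≢v p) (inQ y≢v q)

    agree : ∀ {x} → Q x → g′ x ≡ g x
    agree {x} qx with x ≟ v
    ... | yes refl = contradiction qx ¬qv
    ... | no _ = refl

  extendOverList : ∀ vs {Q} → Decidable Q → ∀ {g} → PartialHom D Q g
    → ∃ λ g′ → PartialHom D (λ x → Q x ⊎ x ∈ vs) g′ × (∀ {x} → Q x → g′ x ≡ g x)
  extendOverList [] {Q} Q? {g} hom = g , (λ p q → hom (inQ p) (inQ q)) , λ _ → refl
    where
    inQ : ∀ {x} → Q x ⊎ x ∈ [] → Q x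
    inQ (inj₁ qx) = qx
  extendOverList (v ∷ vs) {Q} Q? hom =
    let g₁ , hom₁ , agree₁ = extendByVertex Q? hom v
        g₂ , hom₂ , agree₂ = extendOverList vs (λ x → Q? x ⊎-dec (x ≟ v)) hom₁
    in g₂ , (λ p q → hom₂ (regroup p) (regroup q)) , λ qx → trans (agree₂ (inj₁ qx)) (agree₁ qx)
    where
    regroup : ∀ {x} → Q x ⊎ x ∈ v ∷ vs → (Q x ⊎ x ≡ v) ⊎ x ∈ vs
    regroup (inj₁ qx) = inj₁ (inj₁ qx)
    regroup (inj₂ (here refl)) = inj₁ (inj₂ refl)
    regroup (inj₂ (there x∈vs)) = inj₂ x∈vs

  onePointExtension⇒homHomogeneous : HomHomogeneous D
  onePointExtension⇒homHomogeneous U _ _ _ h (_ , h-hom) = F , F-endo , F-h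
    where
    g : V → V
    g x with x ∈ₛ? U
    ... | yes p = h x p
    ... | no _ = x

    g≡h : ∀ x p → g x ≡ h x p
    g≡h x p with x ∈ₛ? U
    ... | yes p′ = cong (h x) (∈ₛ-irrelevant p′ p)
    ... | no p∉U = contradiction p p∉U

    g-hom : PartialHom D (_∈ₛ U) g
    g-hom {x} {y} p q e = subst₂ (Edge D) (sym (g≡h x p)) (sym (g≡h y q)) (h-hom x y p q e)

    extension = extendOverList (allFin _) (_∈ₛ? U) g-hom
    F = proj₁ extension

    F-endo : IsEndomorphism D F
    F-endo x y = proj₁ (proj₂ extension) (inj₂ (∈-allFin x)) (inj₂ (∈-allFin y))

    F-h : ∀ x p → F x ≡ h x p
    F-h x p = trans (proj₂ (proj₂ extension) p) (g≡h x p)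

-- Obstructions to homogeneity

record Embedding (G D : Digraph) : Set where
  field
    map : Vertex G → Vertex D
    injective : ∀ {x y} → map x ≡ map y → x ≡ y
    preserves : ∀ {x y} → Edge G x y → Edge D (map x) (map y)
    reflects : ∀ {x y} → Edge D (map x) (map y) → Edge G x y

-- sources i ↦ images i is a homomorphism on in-neighbours of the target whose image contains
-- z ⇄ z′ (distinct) together with w ↛ z and w′ ↛ z′; in a tournament with involution no vertex
-- receives edges from all of that image (¬obstruction)
IsObstruction : (G : Digraph) → Vertex G → (sources images : Fin 4 → Vertex G)
  → (z z′ w w′ : Fin 4) → Set
IsObstruction G target sources images z z′ w w′ =
  (∀ i → Edge G (sources i) target) × (∀ i j → sources i ≡ sources j → i ≡ j)
  × (∀ i j → Edge G (sources i) (sources j) → Edge G (images i) (images j))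
  × images z ≢ images z′ × Edge G (images z) (images z′) × Edge G (images z′) (images z)
  × ¬ Edge G (images w) (images z) × ¬ Edge G (images w′) (images z′)

isObstruction? : (G : Digraph) → ∀ target sources images z z′ w w′
  → Dec (IsObstruction G target sources images z z′ w w′)
isObstruction? G target sources images z z′ w w′ =
  all? (λ i → Edge? G (sources i) target)
  ×-dec all? (λ i → all? λ j → (sources i ≟ sources j) →-dec (i ≟ j))
  ×-dec all? (λ i → all? λ j → Edge? G (sources i) (sources j) →-dec Edge? G (images i) (images j))
  ×-dec ¬? (images z ≟ images z′) ×-dec Edge? G (images z) (images z′)
  ×-dec Edge? G (images z′) (images z)
  ×-dec ¬? (Edge? G (images w) (images z)) ×-dec ¬? (Edge? G (images w′) (images z′))

record Obstruction (G : Digraph) : Set where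
  constructor obstruction
  field
    target : Vertex G
    sources images : Fin 4 → Vertex G
    z z′ w w′ : Fin 4
    valid : IsObstruction G target sources images z z′ w w′

checkObstruction : ∀ {G} target sources images z z′ w w′
  → True (isObstruction? G target sources images z z′ w w′) → Obstruction G
checkObstruction target sources images z z′ w w′ ok =
  obstruction target sources images z z′ w w′ (toWitness ok)

Obstruction-transport : ∀ {G D} → Embedding G D → Obstruction G → Obstruction D
Obstruction-transport e
  (obstruction t s m z z′ w w′ (s→t , s-inj , m-hom , z≢z′ , zz′ , z′z , w↛z , w′↛z′)) =
  obstruction (map t) (map ∘ s) (map ∘ m) z z′ w w′
    ( (λ i → preserves (s→t i)) , (λ i j eq → s-inj i j (injective eq))
    , (λ i j e → preserves (m-hom i j (reflects e)))
    , z≢z′ ∘ injective , preserves zz′ , preserves z′z , w↛z ∘ reflects , w′↛z′ ∘ reflects )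
  where open Embedding e

-- The digraphs T(B)

T⊎T-not : ∀ b → T b ⊎ T (not b)
T⊎T-not true = inj₁ tt
T⊎T-not false = inj₂ tt

T-not⇒¬T : ∀ {b} → T (not b) → ¬ T b
T-not⇒¬T {false} _ ()

transTour-total : ∀ {n} (i j : Fin n) → i ≢ j → T (transTour n i j) ⊎ T (transTour n j i)
transTour-total i j _ = [ inj₁ ∘ fromWitness , inj₂ ∘ fromWitness ]′ (≤-total i j)

B₄-total : ∀ i j → i ≢ j → T (B₄ i j) ⊎ T (B₄ j i)
B₄-total = toWitness {a? = decision} tt
  where
  decision : Dec (∀ i j → i ≢ j → T (B₄ i j) ⊎ T (B₄ j i))
  decision = all? λ i → all? λ j → ¬? (i ≟ j) →-dec (T? (B₄ i j) ⊎-dec T? (B₄ j i))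

B₄+ : Vec Bool 4 → Fin 5 → Fin 5 → Bool
B₄+ p zero zero = true
B₄+ p zero (suc j) = lookup p j
B₄+ p (suc i) zero = not (lookup p i)
B₄+ p (suc i) (suc j) = B₄ i j

B₄+-total : ∀ p i j → i ≢ j → T (B₄+ p i j) ⊎ T (B₄+ p j i)
B₄+-total p zero zero i≢j = contradiction refl i≢j
B₄+-total p zero (suc j) _ = T⊎T-not (lookup p j)
B₄+-total p (suc i) zero _ = swap (T⊎T-not (lookup p i))
B₄+-total p (suc i) (suc j) i≢j = B₄-total i j (i≢j ∘ cong suc)

-- In T(B₄+ p), 0 is the new vertex, 1–4 are s, p, q, r and 5–9 their partners.
obstruction-T[B₄+] : ∀ p → Obstruction (TB 5 (B₄+ p))
obstruction-T[B₄+] (false ∷ false ∷ false ∷ false ∷ []) = checkObstruction (# 2)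
  (lookup (# 4 ∷ # 5 ∷ # 6 ∷ # 8 ∷ [])) (lookup (# 0 ∷ # 1 ∷ # 2 ∷ # 6 ∷ [])) (# 1) (# 3) (# 0) (# 2) tt
obstruction-T[B₄+] (false ∷ false ∷ false ∷ true ∷ []) = checkObstruction (# 1)
  (lookup (# 2 ∷ # 3 ∷ # 4 ∷ # 5 ∷ [])) (lookup (# 0 ∷ # 4 ∷ # 1 ∷ # 9 ∷ [])) (# 1) (# 3) (# 2) (# 0) tt
obstruction-T[B₄+] (false ∷ false ∷ true ∷ false ∷ []) = checkObstruction (# 1)
  (lookup (# 2 ∷ # 3 ∷ # 4 ∷ # 5 ∷ [])) (lookup (# 0 ∷ # 3 ∷ # 1 ∷ # 5 ∷ [])) (# 0) (# 3) (# 1) (# 2) tt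
obstruction-T[B₄+] (false ∷ false ∷ true ∷ true ∷ []) = checkObstruction (# 1)
  (lookup (# 2 ∷ # 3 ∷ # 4 ∷ # 5 ∷ [])) (lookup (# 0 ∷ # 3 ∷ # 1 ∷ # 8 ∷ [])) (# 1) (# 3) (# 2) (# 0) tt
obstruction-T[B₄+] (false ∷ true ∷ false ∷ false ∷ []) = checkObstruction (# 1)
  (lookup (# 2 ∷ # 3 ∷ # 4 ∷ # 5 ∷ [])) (lookup (# 0 ∷ # 2 ∷ # 1 ∷ # 6 ∷ [])) (# 2) (# 3) (# 0) (# 1) tt
obstruction-T[B₄+] (false ∷ true ∷ false ∷ true ∷ []) = checkObstruction (# 1)
  (lookup (# 2 ∷ # 3 ∷ # 4 ∷ # 5 ∷ [])) (lookup (# 0 ∷ # 2 ∷ # 1 ∷ # 6 ∷ [])) (# 2) (# 3) (# 0) (# 1) tt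
obstruction-T[B₄+] (false ∷ true ∷ true ∷ false ∷ []) = checkObstruction (# 1)
  (lookup (# 2 ∷ # 3 ∷ # 4 ∷ # 5 ∷ [])) (lookup (# 0 ∷ # 2 ∷ # 1 ∷ # 5 ∷ [])) (# 0) (# 3) (# 1) (# 2) tt
obstruction-T[B₄+] (false ∷ true ∷ true ∷ true ∷ []) = checkObstruction (# 2)
  (lookup (# 0 ∷ # 4 ∷ # 6 ∷ # 8 ∷ [])) (lookup (# 0 ∷ # 2 ∷ # 4 ∷ # 9 ∷ [])) (# 2) (# 3) (# 1) (# 0) tt
obstruction-T[B₄+] (true ∷ false ∷ false ∷ false ∷ []) = checkObstruction (# 2)
  (lookup (# 4 ∷ # 5 ∷ # 6 ∷ # 8 ∷ [])) (lookup (# 0 ∷ # 2 ∷ # 3 ∷ # 8 ∷ [])) (# 2) (# 3) (# 0) (# 1) tt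
obstruction-T[B₄+] (true ∷ false ∷ false ∷ true ∷ []) = checkObstruction (# 1)
  (lookup (# 0 ∷ # 2 ∷ # 3 ∷ # 4 ∷ [])) (lookup (# 0 ∷ # 2 ∷ # 3 ∷ # 8 ∷ [])) (# 2) (# 3) (# 0) (# 1) tt
obstruction-T[B₄+] (true ∷ false ∷ true ∷ false ∷ []) = checkObstruction (# 1)
  (lookup (# 0 ∷ # 2 ∷ # 3 ∷ # 4 ∷ [])) (lookup (# 0 ∷ # 2 ∷ # 1 ∷ # 5 ∷ [])) (# 0) (# 3) (# 2) (# 1) tt
obstruction-T[B₄+] (true ∷ false ∷ true ∷ true ∷ []) = checkObstruction (# 1)
  (lookup (# 0 ∷ # 2 ∷ # 3 ∷ # 4 ∷ [])) (lookup (# 0 ∷ # 2 ∷ # 1 ∷ # 5 ∷ [])) (# 0) (# 3) (# 2) (# 1) tt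
obstruction-T[B₄+] (true ∷ true ∷ false ∷ false ∷ []) = checkObstruction (# 1)
  (lookup (# 0 ∷ # 2 ∷ # 3 ∷ # 4 ∷ [])) (lookup (# 0 ∷ # 1 ∷ # 5 ∷ # 3 ∷ [])) (# 0) (# 2) (# 1) (# 3) tt
obstruction-T[B₄+] (true ∷ true ∷ false ∷ true ∷ []) = checkObstruction (# 1)
  (lookup (# 0 ∷ # 2 ∷ # 3 ∷ # 4 ∷ [])) (lookup (# 0 ∷ # 1 ∷ # 7 ∷ # 2 ∷ [])) (# 2) (# 3) (# 0) (# 1) tt
obstruction-T[B₄+] (true ∷ true ∷ true ∷ false ∷ []) = checkObstruction (# 1)
  (lookup (# 0 ∷ # 2 ∷ # 3 ∷ # 4 ∷ [])) (lookup (# 0 ∷ # 1 ∷ # 5 ∷ # 4 ∷ [])) (# 0) (# 2) (# 1) (# 3) tt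
obstruction-T[B₄+] (true ∷ true ∷ true ∷ true ∷ []) = checkObstruction (# 2)
  (lookup (# 0 ∷ # 4 ∷ # 6 ∷ # 8 ∷ [])) (lookup (# 0 ∷ # 1 ∷ # 6 ∷ # 5 ∷ [])) (# 0) (# 3) (# 1) (# 2) tt

ζ₄-inTriangleCondition : InTriangleCondition ζ₄
ζ₄-inTriangleCondition = inj₂ (exhausts , bounded)
  where
  exhausts : InTriangleExhausts ζ₄
  exhausts v a b c x abc = toWitness {a? = decision} tt v a b c abc x
    where
    decision : Dec (∀ v a b c → InTriangle ζ₄ v a b c
                      → ∀ x → Strict ζ₄ x v → x ≡ a ⊎ x ≡ b ⊎ x ≡ c)
    decision = all? λ v → all? λ a → all? λ b → all? λ c → InTriangle? ζ₄ v a b c →-dec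
      all? λ x → Strict? ζ₄ x v →-dec ((x ≟ a) ⊎-dec (x ≟ b) ⊎-dec (x ≟ c))

  bounded : TrianglesBoundedAbove ζ₄
  bounded = toWitness {a? = decision} tt
    where
    decision : Dec (TrianglesBoundedAbove ζ₄)
    decision = all? λ a → all? λ b → all? λ c →
      (Strict? ζ₄ a b ×-dec Strict? ζ₄ b c ×-dec Strict? ζ₄ c a) →-dec
      any? (λ t → Edge? ζ₄ a t ×-dec Edge? ζ₄ b t ×-dec Edge? ζ₄ c t)

module _ (k : ℕ) where
  private
    G : Digraph
    G = TB k (transTour k)

    inB : Fin (k + k) → Bool
    inB u = [ (λ _ → true) , (λ _ → false) ]′ (splitAt k u)

    index : Fin (k + k) → ℕ
    index u = [ toℕ , toℕ ]′ (splitAt k u)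

    index<k : ∀ u → index u < k
    index<k u with splitAt k u
    ... | inj₁ a = toℕ<n a
    ... | inj₂ a = toℕ<n a

    Precedes : Bool → ℕ → Bool → ℕ → Set
    Precedes true i true j = i ≤ j
    Precedes false i false j = i ≤ j
    Precedes true i false j = j ≤ i
    Precedes false i true j = j ≤ i

    sameSide : ∀ (a b : Fin k)
      → (T (⌊ a ≟ b ⌋ ∨ (⌊ a ≤? b ⌋ ∧ not ⌊ a ≟ b ⌋)) → toℕ a ≤ toℕ b)
      × (toℕ a ≤ toℕ b → T (⌊ a ≟ b ⌋ ∨ (⌊ a ≤? b ⌋ ∧ not ⌊ a ≟ b ⌋)))
    sameSide a b with a ≟ b
    ... | yes refl = (λ _ → ℕ.≤-refl) , (λ _ → tt)
    ... | no _ with a ≤? b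
    ...   | yes a≤b = (λ _ → a≤b) , (λ _ → tt)
    ...   | no a≰b = (λ ()) , a≰b

    otherSide : ∀ (a b : Fin k)
      → (T (⌊ a ≟ b ⌋ ∨ (⌊ b ≤? a ⌋ ∧ not ⌊ b ≟ a ⌋)) → toℕ b ≤ toℕ a)
      × (toℕ b ≤ toℕ a → T (⌊ a ≟ b ⌋ ∨ (⌊ b ≤? a ⌋ ∧ not ⌊ b ≟ a ⌋)))
    otherSide a b with a ≟ b | b ≟ a
    ... | yes refl | _ = (λ _ → ℕ.≤-refl) , (λ _ → tt)
    ... | no a≢b | yes b≡a = contradiction (sym b≡a) a≢b
    ... | no _ | no _ with b ≤? a
    ...   | yes b≤a = (λ _ → b≤a) , (λ _ → tt)
    ...   | no b≰a = (λ ()) , b≰a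

    edge⇔precedes : ∀ u w
      → (Edge G u w → Precedes (inB u) (index u) (inB w) (index w))
      × (Precedes (inB u) (index u) (inB w) (index w) → Edge G u w)
    edge⇔precedes u w with splitAt k u | splitAt k w
    ... | inj₁ a | inj₁ b = sameSide a b
    ... | inj₂ a | inj₂ b = sameSide a b
    ... | inj₁ a | inj₂ b = otherSide a b
    ... | inj₂ a | inj₁ b = otherSide a b

    -- The edges of G run forward along the cycle 0, …, k-1, 0′, …, (k-1)′ by less than half a
    -- turn. So In°(v) is the half-turn arc ending at v, and the position on the cycle counted
    -- from the first vertex on the other side than v increases along strict edges inside it.
    position : Bool → Bool → ℕ → ℕ
    position true true i = k + i
    position false false i = k + i
    position true false i = i
    position false true i = i

    position-increasing : ∀ sv j sx i sy i′ → i < k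
      → ¬ Precedes sv j sx i → ¬ Precedes sv j sy i′ → Precedes sx i sy i′ → ¬ Precedes sy i′ sx i
      → position sv sx i < position sv sy i′
    position-increasing true _ true _ true _ _ _ _ _ y↛x = ℕ.+-monoʳ-< k (ℕ.≰⇒> y↛x)
    position-increasing true _ true _ false _ _ v↛x v↛y x→y _ =
      contradiction (ℕ.<-≤-trans (ℕ.<-trans (ℕ.≰⇒> v↛x) (ℕ.≰⇒> v↛y)) x→y) (ℕ.<-irrefl refl)
    position-increasing true _ false _ true i′ i<k _ _ _ _ = ℕ.<-≤-trans i<k (ℕ.m≤m+n k i′)
    position-increasing true _ false _ false _ _ _ _ _ y↛x = ℕ.≰⇒> y↛x
    position-increasing false _ false _ false _ _ _ _ _ y↛x = ℕ.+-monoʳ-< k (ℕ.≰⇒> y↛x)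
    position-increasing false _ false _ true _ _ v↛x v↛y x→y _ =
      contradiction (ℕ.<-≤-trans (ℕ.<-trans (ℕ.≰⇒> v↛x) (ℕ.≰⇒> v↛y)) x→y) (ℕ.<-irrefl refl)
    position-increasing false _ true _ false i′ i<k _ _ _ _ = ℕ.<-≤-trans i<k (ℕ.m≤m+n k i′)
    position-increasing false _ true _ true _ _ _ _ _ y↛x = ℕ.≰⇒> y↛x

    height : Fin (k + k) → Fin (k + k) → ℕ
    height v x = position (inB v) (inB x) (index x)

    height-increasing : ∀ {v x y} → Strict G x v → Strict G y v → Strict G x y
      → height v x < height v y
    height-increasing {v} {x} {y} (_ , v↛x) (_ , v↛y) (x→y , y↛x) =
      position-increasing (inB v) (index v) (inB x) (index x) (inB y) (index y) (index<k x)
        (v↛x ∘ proj₂ (edge⇔precedes v x)) (v↛y ∘ proj₂ (edge⇔precedes v y))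
        (proj₁ (edge⇔precedes x y) x→y) (y↛x ∘ proj₂ (edge⇔precedes y x))

  noInTriangle-T[transTour] : NoInTriangle (TB k (transTour k))
  noInTriangle-T[transTour] v a b c ((av , bv , cv) , ab , bc , ca) = ℕ.<-irrefl refl (begin-strict
    height v a <⟨ height-increasing av bv ab ⟩
    height v b <⟨ height-increasing bv cv bc ⟩
    height v c <⟨ height-increasing cv av ca ⟩
    height v a ∎)
    where open ℕ.≤-Reasoning

α-inTriangleCondition : ∀ n → InTriangleCondition (α n)
α-inTriangleCondition zero = inj₁ λ { _ _ _ _ ((_ , _ , _) , (_ , no-loop) , _) → no-loop tt }
α-inTriangleCondition (suc n) = inj₁ (noInTriangle-T[transTour] (suc n))

-- Tournaments with involution

module TournamentWithInvolution {D : Digraph} {inv : Vertex D → Vertex D}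
                                (tw : IsTournamentWithInvolution D inv) where
  private
    V : Set
    V = Vertex D

  infix 4 _⟶_ _⇀_

  _⟶_ : V → V → Set
  _⟶_ = Edge D

  _⇀_ : V → V → Set
  _⇀_ = Strict D

  loop : ∀ x → x ⟶ x
  loop = proj₁ (proj₁ tw)

  improper : Improper D
  improper = proj₁ (proj₂ (proj₁ tw))

  inv-involutive : ∀ x → inv (inv x) ≡ x
  inv-involutive = proj₁ (proj₂ (proj₂ (proj₂ (proj₁ tw))))

  into-inv : ∀ {x y} → x ⟶ y → y ⟶ inv x
  into-inv {x} {y} = proj₁ (proj₂ (proj₂ (proj₂ (proj₂ (proj₁ tw))))) x y

  bothWays-distinct : ∀ {x y} → x ≢ y → x ⟶ y → y ⟶ x → y ≡ inv x
  bothWays-distinct {x} {y} x≢y xy yx =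
    proj₂ (proj₂ (proj₂ (proj₂ (proj₂ (proj₁ tw))))) x y x≢y (xy , yx)

  total : ∀ x y → x ⟶ y ⊎ y ⟶ x
  total = proj₂ tw

  reverse : ∀ {x y} → ¬ x ⟶ y → y ⟶ x
  reverse {x} {y} x↛y = [ (λ xy → contradiction xy x↛y) , id ]′ (total x y)

  inv-preserves : ∀ {x y} → x ⟶ y → inv x ⟶ inv y
  inv-preserves = into-inv ∘ into-inv

  inv-reflects : ∀ {x y} → inv x ⟶ inv y → x ⟶ y
  inv-reflects {x} {y} = subst₂ _⟶_ (inv-involutive x) (inv-involutive y) ∘ inv-preserves

  from-inv : ∀ {x y} → x ⟶ y → inv y ⟶ x
  from-inv {x} {y} = subst (inv y ⟶_) (inv-involutive x) ∘ into-inv ∘ inv-preserves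

  into-inv⁻¹ : ∀ {x y} → y ⟶ inv x → x ⟶ y
  into-inv⁻¹ {x} {y} = subst (_⟶ y) (inv-involutive x) ∘ from-inv

  from-inv⁻¹ : ∀ {x y} → inv y ⟶ x → x ⟶ y
  from-inv⁻¹ {x} {y} = subst (x ⟶_) (inv-involutive y) ∘ into-inv

  bothWays : ∀ {x y} → x ⟶ y → y ⟶ x → y ≡ x ⊎ y ≡ inv x
  bothWays {x} {y} xy yx with x ≟ y
  ... | yes x≡y = inj₁ (sym x≡y)
  ... | no x≢y = inj₂ (bothWays-distinct x≢y xy yx)

  bothWays⇒≡ : ∀ {x y} → y ≢ inv x → x ⟶ y → y ⟶ x → x ≡ y
  bothWays⇒≡ y≢x′ xy yx = [ sym , (λ y≡x′ → contradiction y≡x′ y≢x′) ]′ (bothWays xy yx)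

  inv-injective : ∀ {x y} → inv x ≡ inv y → x ≡ y
  inv-injective {x} {y} eq = trans (sym (inv-involutive x)) (trans (cong inv eq) (inv-involutive y))

  ⟶-inv : ∀ x → x ⟶ inv x
  ⟶-inv x = into-inv (loop x)

  inv-⟶ : ∀ x → inv x ⟶ x
  inv-⟶ x = from-inv (loop x)

  -- a fixed point of inv would be joined both ways to every vertex, forcing D = 1°
  inv-irreflexive : ∀ x → inv x ≢ x
  inv-irreflexive x x′≡x = proj₁ improper symmetric
    where
    collapse : ∀ {y} → y ≡ x ⊎ y ≡ inv x → y ≡ x
    collapse = [ id , (λ y≡x′ → trans y≡x′ x′≡x) ]′

    everything≡x : ∀ y → y ≡ x
    everything≡x y with total x y
    ... | inj₁ xy = collapse (bothWays xy (subst (y ⟶_) x′≡x (into-inv xy)))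
    ... | inj₂ yx = collapse (bothWays (subst (_⟶ y) x′≡x (from-inv yx)) yx)

    symmetric : SymmetricE D
    symmetric a b ab rewrite everything≡x a | everything≡x b = ab

  strict : ∀ {x y} → x ≢ y → y ≢ inv x → x ⟶ y → x ⇀ y
  strict x≢y y≢x′ xy = xy , [ (λ y≡x → x≢y (sym y≡x)) , y≢x′ ]′ ∘ bothWays xy

  strict⇒≢ : ∀ {x y} → x ⇀ y → x ≢ y
  strict⇒≢ (xy , y↛x) refl = y↛x xy

  strict⇒≢inv : ∀ {x y} → x ⇀ y → y ≢ inv x
  strict⇒≢inv {x} (_ , y↛x) refl = y↛x (inv-⟶ x)

  strict⇒≢inv′ : ∀ {x y} → x ⇀ y → x ≢ inv y
  strict⇒≢inv′ {y = y} (_ , y↛x) refl = y↛x (⟶-inv y)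

  inNeighbours-notPartners : ∀ {v x y} → x ⇀ v → y ⇀ v → y ≢ inv x
  inNeighbours-notPartners (_ , v↛x) (y→v , _) refl = v↛x (from-inv⁻¹ y→v)

  module _ {k : ℕ} {B : Fin k → Fin k → Bool}
           (B-total : ∀ i j → i ≢ j → T (B i j) ⊎ T (B j i))
           {r : Fin k → V} (realises : ∀ i j → i ≢ j → T (B i j) → r i ⇀ r j) where

    private
      apart : ∀ i j → i ≢ j → r i ≢ r j × r i ≢ inv (r j)
      apart i j i≢j with B-total i j i≢j
      ... | inj₁ bij = strict⇒≢ (realises i j i≢j bij) , strict⇒≢inv′ (realises i j i≢j bij)
      ... | inj₂ bji = strict⇒≢ (realises j i (i≢j ∘ sym) bji) ∘ sym
                     , strict⇒≢inv (realises j i (i≢j ∘ sym) bji)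

      r-injective : ∀ {i j} → r i ≡ r j → i ≡ j
      r-injective {i} {j} eq with i ≟ j
      ... | yes i≡j = i≡j
      ... | no i≢j = contradiction eq (proj₁ (apart i j i≢j))

      r-notPartners : ∀ i j → r i ≢ inv (r j)
      r-notPartners i j with i ≟ j
      ... | yes refl = inv-irreflexive (r i) ∘ sym
      ... | no i≢j = proj₂ (apart i j i≢j)

      r-edge : ∀ i j → i ≢ j → (T (B i j) → r i ⟶ r j) × (r i ⟶ r j → T (B i j))
      r-edge i j i≢j = proj₁ ∘ realises i j i≢j , λ rij →
        [ id , (λ bji → contradiction rij (proj₂ (realises j i (i≢j ∘ sym) bji))) ]′ (B-total i j i≢j)

      offDiagonal : ∀ {a b} {X : Set} → (r a ⟶ r b → X) → (X → r a ⟶ r b) → a ≢ b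
        → (T (B a b ∧ true) → X) × (X → T (B a b ∧ true))
      offDiagonal {a} {b} to back a≢b =
          to ∘ proj₁ (r-edge a b a≢b) ∘ subst T (∧-identityʳ (B a b))
        , subst T (sym (∧-identityʳ (B a b))) ∘ proj₂ (r-edge a b a≢b) ∘ back

    T-map : Fin (k + k) → V
    T-map u = [ r , inv ∘ r ]′ (splitAt k u)

    T-map-edge : ∀ u w
      → (T (TAdj k B u w) → T-map u ⟶ T-map w) × (T-map u ⟶ T-map w → T (TAdj k B u w))
    T-map-edge u w with splitAt k u | splitAt k w
    ... | inj₁ a | inj₁ b with a ≟ b
    ...   | yes refl = (λ _ → loop (r a)) , _
    ...   | no a≢b = offDiagonal id id a≢b
    T-map-edge u w | inj₂ a | inj₂ b with a ≟ b
    ...   | yes refl = (λ _ → loop (inv (r a))) , _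
    ...   | no a≢b = offDiagonal inv-preserves inv-reflects a≢b
    T-map-edge u w | inj₁ a | inj₂ b with a ≟ b | b ≟ a
    ...   | yes refl | _ = (λ _ → ⟶-inv (r a)) , _
    ...   | no a≢b | yes b≡a = contradiction (sym b≡a) a≢b
    ...   | no _ | no b≢a = offDiagonal into-inv into-inv⁻¹ b≢a
    T-map-edge u w | inj₂ a | inj₁ b with a ≟ b | b ≟ a
    ...   | yes refl | _ = (λ _ → inv-⟶ (r a)) , _
    ...   | no a≢b | yes b≡a = contradiction (sym b≡a) a≢b
    ...   | no _ | no b≢a = offDiagonal from-inv from-inv⁻¹ b≢a

    T-map-injective : ∀ {u w} → T-map u ≡ T-map w → u ≡ w
    T-map-injective {u} {w} eq = begin
      u                      ≡⟨ join-splitAt k k u ⟨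
      join k k (splitAt k u) ≡⟨ cong (join k k) (sameHalf eq) ⟩
      join k k (splitAt k w) ≡⟨ join-splitAt k k w ⟩
      w                      ∎
      where
      open ≡-Reasoning
      sameHalf : T-map u ≡ T-map w → splitAt k u ≡ splitAt k w
      sameHalf eq with splitAt k u | splitAt k w
      ... | inj₁ a | inj₁ b = cong inj₁ (r-injective eq)
      ... | inj₂ a | inj₂ b = cong inj₂ (r-injective (inv-injective eq))
      ... | inj₁ a | inj₂ b = contradiction eq (r-notPartners a b)
      ... | inj₂ a | inj₁ b = contradiction (sym eq) (r-notPartners b a)

    T-embedding : Embedding (TB k B) D
    T-embedding = record
      { map = T-map
      ; injective = T-map-injective
      ; preserves = λ {u} {w} → proj₁ (T-map-edge u w)
      ; reflects = λ {u} {w} → proj₂ (T-map-edge u w)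
      }

    T-iso : (∀ x → ∃ λ i → x ≡ r i ⊎ x ≡ inv (r i)) → D ≅ TB k B
    T-iso covers = from , T-map , T-map∘from , from∘T-map , λ x y →
        (proj₂ (T-map-edge (from x) (from y)) ∘ subst₂ _⟶_ (sym (T-map∘from x)) (sym (T-map∘from y)))
      , (subst₂ _⟶_ (T-map∘from x) (T-map∘from y) ∘ proj₁ (T-map-edge (from x) (from y)))
      where
      half : V → Fin k ⊎ Fin k
      half x = [ (λ _ → inj₁ (proj₁ (covers x))) , (λ _ → inj₂ (proj₁ (covers x))) ]′
                 (proj₂ (covers x))

      from : V → Fin (k + k)
      from x = join k k (half x)

      T-map∘from : ∀ x → T-map (from x) ≡ x
      T-map∘from x rewrite splitAt-join k k (half x) with covers x
      ... | i , inj₁ x≡ri = sym x≡ri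
      ... | i , inj₂ x≡ri′ = sym x≡ri′

      from∘T-map : ∀ u → from (T-map u) ≡ u
      from∘T-map u = T-map-injective (T-map∘from (T-map u))

  someVertex : V
  someVertex with any? {P = λ (_ : V) → ⊤} (λ _ → yes tt)
  ... | yes (x , _) = x
  ... | no none = contradiction (λ x _ _ → contradiction (x , tt) none) (proj₁ improper)

  module _ (noInTriangle : NoInTriangle D) where
    private
      v₀ : V
      v₀ = someVertex

      -- one vertex of each pair {x, x′}: the copy of B in D ≅ T(B)
      Half : V → Set
      Half x = v₀ ⟶ x × x ≢ inv v₀

      half? : Decidable Half
      half? x = Edge? D v₀ x ×-dec ¬? (x ≟ inv v₀)

      half-v₀ : Half v₀
      half-v₀ = loop v₀ , inv-irreflexive v₀ ∘ sym

      half-notPartners : ∀ {x y} → Half x → Half y → y ≢ inv x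
      half-notPartners (v₀→x , x≢v₀′) (v₀→y , y≢v₀′) refl
        with bothWays v₀→x (into-inv⁻¹ v₀→y)
      ... | inj₁ refl = y≢v₀′ refl
      ... | inj₂ x≡v₀′ = x≢v₀′ x≡v₀′

      half-antisym : ∀ {x y} → Half x → Half y → x ⟶ y → y ⟶ x → x ≡ y
      half-antisym hx hy = bothWays⇒≡ (half-notPartners hx hy)

      half-strict : ∀ {x y} → Half x → Half y → x ≢ y → x ⟶ y → x ⇀ y
      half-strict hx hy x≢y = strict x≢y (half-notPartners hx hy)

      half⇀v₀′ : ∀ {x} → Half x → x ≢ v₀ → x ⇀ inv v₀
      half⇀v₀′ (v₀→x , x≢v₀′) x≢v₀ =
        strict x≢v₀′ (x≢v₀ ∘ sym ∘ inv-injective) (into-inv v₀→x)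

      half-trans : ∀ {x y z} → Half x → Half y → Half z → x ⟶ y → y ⟶ z → x ⟶ z
      half-trans {x} {y} {z} hx hy hz xy yz with x ≟ y | y ≟ z | Edge? D x z
      ... | yes refl | _ | _ = yz
      ... | _ | yes refl | _ = xy
      ... | _ | _ | yes xz = xz
      ... | no x≢y | no y≢z | no x↛z = contradiction
        ( (half⇀v₀′ hx x≢v₀ , half⇀v₀′ hy y≢v₀ , half⇀v₀′ hz z≢v₀)
        , half-strict hx hy x≢y xy , half-strict hy hz y≢z yz , (reverse x↛z , x↛z) )
        (noInTriangle (inv v₀) x y z)
        where
        x≢v₀ : x ≢ v₀
        x≢v₀ refl = x↛z (proj₁ hz)
        y≢v₀ : y ≢ v₀
        y≢v₀ refl = x≢y (half-antisym hx hy xy (proj₁ hx))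
        z≢v₀ : z ≢ v₀
        z≢v₀ refl = y≢z (half-antisym hy hz yz (proj₁ hy))

      half-or-inv : ∀ x → Half x ⊎ Half (inv x)
      half-or-inv x with x ≟ v₀ | x ≟ inv v₀ | total v₀ x
      ... | yes refl | _ | _ = inj₁ half-v₀
      ... | no _ | yes refl | _ = inj₂ (subst Half (sym (inv-involutive v₀)) half-v₀)
      ... | no _ | no x≢v₀′ | inj₁ v₀→x = inj₁ (v₀→x , x≢v₀′)
      ... | no x≢v₀ | no _ | inj₂ x→v₀ = inj₂ (into-inv x→v₀ , x≢v₀ ∘ inv-injective)

      open Enumeration (enumerate half? (Edge? D) loop half-trans half-antisym (λ _ _ → total _ _))

      realises : ∀ i j → i ≢ j → T (transTour count i j) → enum i ⇀ enum j
      realises i j i≢j i≤j with enum-strictMono (≤∧≢⇒< (toWitness i≤j) i≢j)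
      ... | ij , ri≢rj = half-strict (enum-∈ i) (enum-∈ j) ri≢rj ij

      covers : ∀ x → ∃ λ i → x ≡ enum i ⊎ x ≡ inv (enum i)
      covers x with half-or-inv x
      ... | inj₁ hx = let i , ri≡x = enum-onto hx in i , inj₁ (sym ri≡x)
      ... | inj₂ hx′ = let i , ri≡x′ = enum-onto hx′ in
        i , inj₂ (trans (sym (inv-involutive x)) (cong inv (sym ri≡x′)))

      as-α : ∀ {m} → Fin m → D ≅ TB m (transTour m) → ∃ λ n → D ≅ α n
      as-α {suc m} _ iso = suc m , iso

    noInTriangle⇒α : ∃ λ n → D ≅ α n
    noInTriangle⇒α = as-α (proj₁ (enum-onto half-v₀)) (T-iso transTour-total realises covers)

  -- z′ = inv z, so a common out-neighbour t of z and z′ satisfies t ⇄ z, i.e. t ∈ {z, z′}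
  noCommonOutNeighbour : ∀ {z z′ w w′ t}
    → z ≢ z′ → z ⟶ z′ → z′ ⟶ z → ¬ w ⟶ z → ¬ w′ ⟶ z′ → z ⟶ t → z′ ⟶ t → w ⟶ t → w′ ⟶ t → ⊥
  noCommonOutNeighbour z≢z′ zz′ z′z w↛z w′↛z′ zt z′t wt w′t
    with refl ← bothWays-distinct z≢z′ zz′ z′z
    with bothWays zt (from-inv⁻¹ z′t)
  ... | inj₁ refl = w↛z wt
  ... | inj₂ refl = w′↛z′ w′t

  ¬obstruction : HomHomogeneous D → ¬ Obstruction D
  ¬obstruction hh (obstruction target sources images z z′ w w′
                    (s→t , s-inj , hom , z≢z′ , zz′ , z′z , w↛z , w′↛z′))
    with t , images→t ← homHomogeneous⇒commonOutNeighbour hh target sources images s→t s-inj hom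
    = noCommonOutNeighbour z≢z′ zz′ z′z w↛z w′↛z′
        (images→t z) (images→t z′) (images→t w) (images→t w′)

  module _ (hh : HomHomogeneous D) {v a b c} (vabc : InTriangle D v a b c) where
    private
      a⇀v : a ⇀ v
      a⇀v = proj₁ (proj₁ vabc)
      b⇀v : b ⇀ v
      b⇀v = proj₁ (proj₂ (proj₁ vabc))
      c⇀v : c ⇀ v
      c⇀v = proj₂ (proj₂ (proj₁ vabc))
      a⇀b : a ⇀ b
      a⇀b = proj₁ (proj₂ vabc)
      b⇀c : b ⇀ c
      b⇀c = proj₁ (proj₂ (proj₂ vabc))
      c⇀a : c ⇀ a
      c⇀a = proj₂ (proj₂ (proj₂ vabc))

      corners : Vec V 4
      corners = v ∷ a ∷ b ∷ c ∷ []

      corner : Fin 4 → V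
      corner = lookup corners

      corners-realise : ∀ i j → i ≢ j → T (B₄ i j) → corner i ⇀ corner j
      corners-realise zero zero i≢j _ = contradiction refl i≢j
      corners-realise zero (suc _) _ ()
      corners-realise (suc zero) zero _ _ = a⇀v
      corners-realise (suc zero) (suc zero) i≢j _ = contradiction refl i≢j
      corners-realise (suc zero) (suc (suc zero)) _ _ = a⇀b
      corners-realise (suc zero) (suc (suc (suc zero))) _ ()
      corners-realise (suc (suc zero)) zero _ _ = b⇀v
      corners-realise (suc (suc zero)) (suc zero) _ ()
      corners-realise (suc (suc zero)) (suc (suc zero)) i≢j _ = contradiction refl i≢j
      corners-realise (suc (suc zero)) (suc (suc (suc zero))) _ _ = b⇀c
      corners-realise (suc (suc (suc zero))) zero _ _ = c⇀v
      corners-realise (suc (suc (suc zero))) (suc zero) _ _ = c⇀a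
      corners-realise (suc (suc (suc zero))) (suc (suc zero)) _ ()
      corners-realise (suc (suc (suc zero))) (suc (suc (suc zero))) i≢j _ = contradiction refl i≢j

      covered : ∀ x → ∃ λ i → x ≡ corner i ⊎ x ≡ inv (corner i)
      covered x with any? (λ i → (x ≟ corner i) ⊎-dec (x ≟ inv (corner i)))
      ... | yes x-covered = x-covered
      ... | no uncovered = contradiction
        (Obstruction-transport (T-embedding (B₄+-total p) realises) (obstruction-T[B₄+] p))
        (¬obstruction hh)
        where
        p : Vec Bool 4
        p = Vec.map (adj D x) corners

        p≡adj : ∀ j → lookup p j ≡ adj D x (corner j)
        p≡adj j = lookup-map j (adj D x) corners

        x≢corner : ∀ j → x ≢ corner j
        x≢corner j x≡ = uncovered (j , inj₁ x≡)

        x≢corner′ : ∀ j → x ≢ inv (corner j)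
        x≢corner′ j x≡ = uncovered (j , inj₂ x≡)

        corner≢x′ : ∀ j → corner j ≢ inv x
        corner≢x′ j eq = x≢corner′ j (trans (sym (inv-involutive x)) (cong inv (sym eq)))

        extended : Fin 5 → V
        extended zero = x
        extended (suc i) = corner i

        realises : ∀ i j → i ≢ j → T (B₄+ p i j) → extended i ⇀ extended j
        realises zero zero i≢j _ = contradiction refl i≢j
        realises zero (suc j) _ x→j = strict (x≢corner j) (corner≢x′ j) (subst T (p≡adj j) x→j)
        realises (suc i) zero _ x↛i = strict (x≢corner i ∘ sym) (x≢corner′ i)
          (reverse (T-not⇒¬T (subst (T ∘ not) (p≡adj i) x↛i)))
        realises (suc i) (suc j) i≢j = corners-realise i j (i≢j ∘ cong suc)

    homHomogeneous⇒ζ₄ : D ≅ ζ₄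
    homHomogeneous⇒ζ₄ = T-iso B₄-total corners-realise covered

  Twins : V → V → Set
  Twins x y = y ≡ x ⊎ y ≡ inv x

  twins? : ∀ x y → Dec (Twins x y)
  twins? x y = (y ≟ x) ⊎-dec (y ≟ inv x)

  twins-⟶ : ∀ {x y} → Twins x y → y ⟶ x
  twins-⟶ {x} (inj₁ refl) = loop x
  twins-⟶ {x} (inj₂ refl) = inv-⟶ x

  twins-trans : ∀ {x y z} → Twins x y → Twins y z → Twins x z
  twins-trans (inj₁ refl) yz = yz
  twins-trans (inj₂ refl) (inj₁ refl) = inj₂ refl
  twins-trans {x} (inj₂ refl) (inj₂ refl) = inj₁ (inv-involutive x)

  module Flip {Q : V → Set} (Q? : Decidable Q) {g : V → V} (hom : PartialHom D Q g)
              {v : V} (¬qv : ¬ Q v) (¬qv′ : ¬ Q (inv v)) where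

    label : V → V
    label u with Edge? D u v
    ... | yes _ = u
    ... | no _ = inv u

    image : V → V
    image u with Edge? D u v
    ... | yes _ = g u
    ... | no _ = inv (g u)

    label⇀v : ∀ {u} → Q u → label u ⇀ v
    label⇀v {u} qu with Edge? D u v
    ... | yes u→v = strict (λ { refl → ¬qv qu })
                           (λ { refl → ¬qv′ (subst Q (sym (inv-involutive u)) qu) }) u→v
    ... | no u↛v = from-inv (reverse u↛v) , u↛v ∘ into-inv⁻¹

    label-hom : ∀ {u w} → Q u → Q w → label u ⟶ label w → image u ⟶ image w
    label-hom {u} {w} qu qw with Edge? D u v | Edge? D w v
    ... | yes _ | yes _ = hom qu qw
    ... | yes _ | no _ = into-inv ∘ hom qw qu ∘ into-inv⁻¹
    ... | no _ | yes _ = from-inv ∘ hom qw qu ∘ from-inv⁻¹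
    ... | no _ | no _ = inv-preserves ∘ hom qu qw ∘ inv-reflects

    module Corner (exhausts : InTriangleExhausts D)
                  {u₁ u₂ u₃ : V} (q₁ : Q u₁) (q₂ : Q u₂) (q₃ : Q u₃)
                  (l₁₂ : label u₁ ⇀ label u₂) (l₂₃ : label u₂ ⇀ label u₃)
                  (l₃₁ : label u₃ ⇀ label u₁) where

      threeLabels : ∀ {u} → Q u → label u ≡ label u₁ ⊎ label u ≡ label u₂ ⊎ label u ≡ label u₃
      threeLabels qu = exhausts v _ _ _ _
        ((label⇀v q₁ , label⇀v q₂ , label⇀v q₃) , l₁₂ , l₂₃ , l₃₁) (label⇀v qu)

      sameLabel⇒twins : ∀ {u w} → Q u → Q w → label u ≡ label w → Twins (image u) (image w)
      sameLabel⇒twins {u} {w} qu qw eq = bothWays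
        (label-hom qu qw (subst (label u ⟶_) eq (loop _)))
        (label-hom qw qu (subst (_⟶ label u) eq (loop _)))

      twins⇒bound : Twins (image u₁) (image u₂) → ∀ {u} → Q u → image u ⟶ image u₁
      twins⇒bound tw {u} qu with threeLabels qu
      ... | inj₁ eq = label-hom qu q₁ (subst (_⟶ label u₁) (sym eq) (loop _))
      ... | inj₂ (inj₁ eq) = twins-⟶ (twins-trans tw (sameLabel⇒twins q₂ qu (sym eq)))
      ... | inj₂ (inj₂ eq) = label-hom qu q₁ (subst (_⟶ label u₁) (sym eq) (proj₁ l₃₁))

      ¬twins⇒sameImage : ¬ Twins (image u₁) (image u₂)
        → ∀ {u} → Q u → label u ≡ label u₁ → image u ≡ image u₁
      ¬twins⇒sameImage ¬tw {u} qu eq with sameLabel⇒twins q₁ qu (sym eq)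
      ... | inj₁ same = same
      ... | inj₂ u≡u₁′ = contradiction
        (bothWays image₁→image₂ (from-inv⁻¹ (subst (_⟶ image u₂) u≡u₁′ image→image₂))) ¬tw
        where
        image₁→image₂ : image u₁ ⟶ image u₂
        image₁→image₂ = label-hom q₁ q₂ (proj₁ l₁₂)
        image→image₂ : image u ⟶ image u₂
        image→image₂ = label-hom qu q₂ (subst (_⟶ label u₂) (sym eq) (proj₁ l₁₂))

    -- Either the images of two corners are twins, and the first of them bounds every image, or
    -- the three corner images form a triangle, each label has a single image, and any upper
    -- bound of that triangle bounds every image.
    triangleBound : InTriangleExhausts D → TrianglesBoundedAbove D → ∀ {u₁ u₂ u₃}
      → Q u₁ → Q u₂ → Q u₃ → Triangle D (label u₁) (label u₂) (label u₃)
      → ∃ λ t → ∀ {u} → Q u → image u ⟶ t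
    triangleBound exhausts bounded {u₁} {u₂} {u₃} q₁ q₂ q₃ (l₁₂ , l₂₃ , l₃₁) =
      bound (twins? (image u₁) (image u₂)) (twins? (image u₂) (image u₃)) (twins? (image u₃) (image u₁))
      where
      module C₁ = Corner exhausts q₁ q₂ q₃ l₁₂ l₂₃ l₃₁
      module C₂ = Corner exhausts q₂ q₃ q₁ l₂₃ l₃₁ l₁₂
      module C₃ = Corner exhausts q₃ q₁ q₂ l₃₁ l₁₂ l₂₃

      image-strict : ∀ {u w} → Q u → Q w → label u ⇀ label w → ¬ Twins (image u) (image w)
        → image u ⇀ image w
      image-strict qu qw (uw , _) ¬tw = label-hom qu qw uw , ¬tw ∘ bothWays (label-hom qu qw uw)

      bound : Dec (Twins (image u₁) (image u₂)) → Dec (Twins (image u₂) (image u₃))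
        → Dec (Twins (image u₃) (image u₁)) → ∃ λ t → ∀ {u} → Q u → image u ⟶ t
      bound (yes tw) _ _ = image u₁ , C₁.twins⇒bound tw
      bound (no _) (yes tw) _ = image u₂ , C₂.twins⇒bound tw
      bound (no _) (no _) (yes tw) = image u₃ , C₃.twins⇒bound tw
      bound (no ¬tw₁₂) (no ¬tw₂₃) (no ¬tw₃₁)
        with bounded _ _ _ ( image-strict q₁ q₂ l₁₂ ¬tw₁₂
                           , image-strict q₂ q₃ l₂₃ ¬tw₂₃
                           , image-strict q₃ q₁ l₃₁ ¬tw₃₁ )
      ... | t , image₁→t , image₂→t , image₃→t = t , image→t
        where
        image→t : ∀ {u} → Q u → image u ⟶ t
        image→t qu with C₁.threeLabels qu
        ... | inj₁ eq = subst (_⟶ t) (sym (C₁.¬twins⇒sameImage ¬tw₁₂ qu eq)) image₁→t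
        ... | inj₂ (inj₁ eq) = subst (_⟶ t) (sym (C₂.¬twins⇒sameImage ¬tw₂₃ qu eq)) image₂→t
        ... | inj₂ (inj₂ eq) = subst (_⟶ t) (sym (C₃.¬twins⇒sameImage ¬tw₃₁ qu eq)) image₃→t

    boundedImage : InTriangleCondition D → ∃ λ t → ∀ {u} → Q u → image u ⟶ t
    boundedImage condition =
      boundedOn (filter Q? (allFin _)) (all-filter Q? (allFin _)) (∈-filter⁺ Q? (∈-allFin _))
      where
      boundedOn : ∀ us → All Q us → (∀ {u} → Q u → u ∈ us)
        → ∃ λ t → ∀ {u} → Q u → image u ⟶ t
      boundedOn [] _ complete = someVertex , λ qu → case complete qu of λ ()
      boundedOn (u ∷ us) qs complete
        with source-or-triangle total (λ xv yv → bothWays⇒≡ (inNeighbours-notPartners xv yv))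
               (All.map⁺ (All.map label⇀v qs))
      ... | inj₁ (m , m∈ , m→) with ∈-map⁻ label m∈
      ...   | u₀ , u₀∈ , refl = inv (image u₀) , λ qu →
        into-inv (label-hom (All.lookup qs u₀∈) qu (All.lookup (All.map⁻ m→) (complete qu)))
      boundedOn (u ∷ us) qs complete
          | inj₂ (a , b , c , (a∈ , b∈ , c∈) , abc)
        with ∈-map⁻ label a∈ | ∈-map⁻ label b∈ | ∈-map⁻ label c∈
      ...   | u₁ , u₁∈ , refl | u₂ , u₂∈ , refl | u₃ , u₃∈ , refl =
        [ (λ none → contradiction ((label⇀v q₁ , label⇀v q₂ , label⇀v q₃) , abc) (none v _ _ _))
        , (λ (exhausts , bounded) → triangleBound exhausts bounded q₁ q₂ q₃ abc)
        ]′ condition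
        where
        q₁ = All.lookup qs u₁∈
        q₂ = All.lookup qs u₂∈
        q₃ = All.lookup qs u₃∈

  module _ (condition : InTriangleCondition D) where

    onePointExtension : OnePointExtension D
    onePointExtension {Q} Q? {g} hom {v} ¬qv with Q? (inv v)
    ... | yes qv′ = inv (g (inv v)) , λ qu →
        (into-inv ∘ hom qv′ qu ∘ from-inv) , (from-inv ∘ hom qu qv′ ∘ into-inv)
    ... | no ¬qv′ = t , extends
      where
      open Flip Q? hom ¬qv ¬qv′
      t = proj₁ (boundedImage condition)

      extends : ∀ {u} → Q u → (u ⟶ v → g u ⟶ t) × (v ⟶ u → t ⟶ g u)
      extends {u} qu with Edge? D u v | proj₂ (boundedImage condition) qu | label⇀v qu
      ... | yes _ | image→t | _ , v↛u = (λ _ → image→t) , λ v→u → contradiction v→u v↛u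
      ... | no u↛v | image→t | _ = (λ u→v → contradiction u→v u↛v) , λ _ → from-inv⁻¹ image→t

    inTriangleCondition⇒homHomogeneous : HomHomogeneous D
    inTriangleCondition⇒homHomogeneous = onePointExtension⇒homHomogeneous loop onePointExtension

theorem4p8 : (D : Digraph) (inv : Fin (size D) → Fin (size D))
    → IsTournamentWithInvolution D inv
    → (HomHomogeneous D → (D ≅ ζ₄ ⊎ ∃ λ (n : ℕ) → D ≅ α n))
      × ((D ≅ ζ₄ ⊎ ∃ λ (n : ℕ) → D ≅ α n) → HomHomogeneous D)
theorem4p8 D inv tw = classify , homogeneous
  where
  open TournamentWithInvolution tw

  classify : HomHomogeneous D → D ≅ ζ₄ ⊎ ∃ λ n → D ≅ α n
  classify hh with any? (λ v → any? λ a → any? λ b → any? λ c → InTriangle? D v a b c)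
  ... | yes (_ , _ , _ , _ , vabc) = inj₁ (homHomogeneous⇒ζ₄ hh vabc)
  ... | no none = inj₂ (noInTriangle⇒α λ v a b c vabc → none (v , a , b , c , vabc))

  homogeneous : D ≅ ζ₄ ⊎ ∃ (λ n → D ≅ α n) → HomHomogeneous D
  homogeneous (inj₁ D≅ζ₄) = inTriangleCondition⇒homHomogeneous
    (InTriangleCondition-transport D≅ζ₄ ζ₄-inTriangleCondition)
  homogeneous (inj₂ (n , D≅α)) = inTriangleCondition⇒homHomogeneous
    (InTriangleCondition-transport D≅α (α-inTriangleCondition n))
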